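{- Let $(\mathbb{C},P)$ be an elementary existential doctrine with singletons. Then the functor $U:\mathbf{Map}_c(\mathbb{C},P)\to\mathbf{Shv}(\mathbb{C},P)$, which is the identity on objects and sends a functional relation $F$ from $Y$ to $A$ (with $A$ complete) to the unique morphism $f:Y\to A$ with $\Gamma f=F$, is an equivalence of categories.
   Context: A doctrine is a pair $(\mathbb{C},P)$ with $\mathbb{C}$ a category with finite products and $P:\mathbb{C}^{op}\to\mathbf{ISL}$ a functor into inf-semilattices; write $f^*=P(f)$, $\wedge$ for meets, $\top_A$ for the top of $P(A)$. It is elementary existential if each $f^*$ has a left adjoint $\exists_f$ satisfying Beck–Chevalley for pullbacks and Frobenius reciprocity. Equality on $A$: $\delta_A=\exists_{\Delta_A}\top_A\in P(A\times A)$. Comprehension of $\alpha\in P(A)$: a morphism $\lfloor\alpha\rfloor:X\to A$ with $\top_X\le\lfloor\alpha\rfloor^*\alpha$ through which every $f:Y\to A$ with $\top_Y\le f^*\alpha$ factors uniquely; $f:X\to Y$ has an image if $\exists_f\top_X$ has a comprehension. Power objects: objects $\mathbb{P}(X)$ and $\in_X\in P(X\times\mathbb{P}(X))$ such that each $\gamma\in P(X\times Y)$ equals $(\mathrm{id}_X\times\{\gamma\})^*\in_X$ for a unique $\{\gamma\}:Y\to\mathbb{P}(X)$. A formula $F\in P(Y\times A)$ is a functional relation from $Y$ to $A$ if $F(y,a)\wedge F(y,a')\le\delta_A(a,a')$ and $\exists a{:}A.\,F(y,a)=\top_Y$ (internal-language notation). Internal graph of $f:Y\to A$: $\Gamma f=(f\times\mathrm{id}_A)^*\delta_A$.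 $\mathbf{Map}(\mathbb{C},P)$ is the category with the objects of $\mathbb{C}$, functional relations as morphisms, identities $\delta_A$ and composition $(G\circ F)(a,c)=\exists b{:}B.\,(F(a,b)\wedge G(b,c))$. $A$ is complete if for every $Y$ and every functional relation $F$ from $Y$ to $A$ there is a unique $f:Y\to A$ with $\Gamma f=F$; $\mathbf{Map}_c(\mathbb{C},P)$ is the full subcategory of $\mathbf{Map}(\mathbb{C},P)$ on complete objects. $f$ is internally bijective if $\delta_A=(f\times f)^*\delta_B$ and $\exists_f\top_A=\top_B$. $A$ is a $P$-sheaf if for every span $Y\xleftarrow{d}X\xrightarrow{q}A$ with $d$ internally bijective there is a unique $h$ with $h\circ d=q$; $\mathbf{Shv}(\mathbb{C},P)$ is the full subcategory of $\mathbb{C}$ on $P$-sheaves (complete objects are $P$-sheaves, so $U$ is well defined). The doctrine has singletons if (i) it has power objects; (ii) each $\{\delta_A\}:A\to\mathbb{P}(A)$ has an image and is internally injective ($\delta_A=(\{\delta_A\}\times\{\delta_A\})^*\delta_{\mathbb{P}(A)}$); (iii) for every $g:Y\to\mathbb{P}(A)$, the formula $(\mathrm{id}_A\times g)^*\in_A$, read as a relation from $Y$ to $A$, is functional iff $g^*(\exists_{\{\delta_A\}}\top_A)=\top_Y$. -}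

module Defs where

open import Level using (Level; _⊔_) renaming (suc to lsuc)
open import Data.Product using (Σ; Σ-syntax; _×_; _,_; proj₁; proj₂)
open import Relation.Binary using (IsEquivalence)

record Category (o ℓ e : Level) : Set (lsuc (o ⊔ ℓ ⊔ e)) where
  infix  4 _≈_
  infixr 9 _∘_
  field
    Obj       : Set o
    Hom       : Obj → Obj → Set ℓ
    _≈_       : ∀ {A B} → Hom A B → Hom A B → Set e
    id        : ∀ {A} → Hom A A
    _∘_       : ∀ {A B C} → Hom B C → Hom A B → Hom A C
    ≈-equiv   : ∀ {A B} → IsEquivalence (_≈_ {A} {B})
    ∘-resp-≈  : ∀ {A B C} {f h : Hom B C} {g i : Hom A B} →
                f ≈ h → g ≈ i → f ∘ g ≈ h ∘ i
    identityˡ : ∀ {A B} {f : Hom A B} → id ∘ f ≈ f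
    identityʳ : ∀ {A B} {f : Hom A B} → f ∘ id ≈ f
    assoc     : ∀ {A B C D} {f : Hom A B} {g : Hom B C} {h : Hom C D} →
                (h ∘ g) ∘ f ≈ h ∘ (g ∘ f)

module _ {o ℓ e} (𝒞 : Category o ℓ e) where
  open Category 𝒞

  IsPullback : ∀ {A B C D} (f : Hom A B) (g : Hom C B) (p : Hom D A) (q : Hom D C) →
               Set (o ⊔ ℓ ⊔ e)
  IsPullback {A} {B} {C} {D} f g p q =
    (f ∘ p ≈ g ∘ q) ×
    (∀ {X} (h : Hom X A) (k : Hom X C) → f ∘ h ≈ g ∘ k →
       Σ[ u ∈ Hom X D ] ((p ∘ u ≈ h) × (q ∘ u ≈ k) ×
         (∀ (u' : Hom X D) → p ∘ u' ≈ h → q ∘ u' ≈ k → u' ≈ u)))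

record FiniteProducts {o ℓ e} (𝒞 : Category o ℓ e) : Set (o ⊔ ℓ ⊔ e) where
  open Category 𝒞
  infixr 7 _⊗_
  field
    𝟙         : Obj
    !         : ∀ {A} → Hom A 𝟙
    !-unique  : ∀ {A} (f : Hom A 𝟙) → f ≈ !
    _⊗_       : Obj → Obj → Obj
    π₁        : ∀ {A B} → Hom (A ⊗ B) A
    π₂        : ∀ {A B} → Hom (A ⊗ B) B
    ⟨_,_⟩     : ∀ {A B C} → Hom C A → Hom C B → Hom C (A ⊗ B)
    π₁-⟨⟩     : ∀ {A B C} {f : Hom C A} {g : Hom C B} → π₁ ∘ ⟨ f , g ⟩ ≈ f
    π₂-⟨⟩     : ∀ {A B C} {f : Hom C A} {g : Hom C B} → π₂ ∘ ⟨ f , g ⟩ ≈ g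
    ⟨⟩-unique : ∀ {A B C} {f : Hom C A} {g : Hom C B} {h : Hom C (A ⊗ B)} →
                π₁ ∘ h ≈ f → π₂ ∘ h ≈ g → h ≈ ⟨ f , g ⟩

  infixr 8 _⁂_
  _⁂_ : ∀ {A B C D} → Hom A B → Hom C D → Hom (A ⊗ C) (B ⊗ D)
  f ⁂ g = ⟨ f ∘ π₁ , g ∘ π₂ ⟩

  Δ : ∀ {A} → Hom A (A ⊗ A)
  Δ = ⟨ id , id ⟩

-- Each P(A) is an inf-semilattice presented by its order _≤_ (a preorder;
-- equality of formulas is α ≅ β, i.e. α ≤ β and β ≤ α); reindexing f* is
-- written  reindex f .

record Doctrine {o ℓ e} (𝒞 : Category o ℓ e) (FP : FiniteProducts 𝒞) (p q : Level)
       : Set (o ⊔ ℓ ⊔ e ⊔ lsuc (p ⊔ q)) where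
  open Category 𝒞
  infix  4 _≤_ _≅_
  infixr 6 _∧_
  field
    P        : Obj → Set p
    _≤_      : ∀ {A} → P A → P A → Set q
    ≤-refl   : ∀ {A} {α : P A} → α ≤ α
    ≤-trans  : ∀ {A} {α β γ : P A} → α ≤ β → β ≤ γ → α ≤ γ
    top      : ∀ A → P A
    top-max  : ∀ {A} {α : P A} → α ≤ top A
    _∧_      : ∀ {A} → P A → P A → P A
    ∧-lb₁    : ∀ {A} {α β : P A} → α ∧ β ≤ α
    ∧-lb₂    : ∀ {A} {α β : P A} → α ∧ β ≤ β
    ∧-glb    : ∀ {A} {α β γ : P A} → γ ≤ α → γ ≤ β → γ ≤ α ∧ β
    reindex  : ∀ {A B} → Hom A B → P B → P A

  _≅_ : ∀ {A} → P A → P A → Set q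
  α ≅ β = (α ≤ β) × (β ≤ α)

  field
    reindex-mono : ∀ {A B} (f : Hom A B) {α β : P B} → α ≤ β → reindex f α ≤ reindex f β
    reindex-∧    : ∀ {A B} (f : Hom A B) {α β : P B} →
                   reindex f (α ∧ β) ≅ reindex f α ∧ reindex f β
    reindex-top  : ∀ {A B} (f : Hom A B) → reindex f (top B) ≅ top A
    reindex-id   : ∀ {A} {α : P A} → reindex id α ≅ α
    reindex-∘    : ∀ {A B C} (f : Hom A B) (g : Hom B C) {α : P C} →
                   reindex (g ∘ f) α ≅ reindex f (reindex g α)
    reindex-resp : ∀ {A B} {f g : Hom A B} → f ≈ g → ∀ {α : P B} → reindex f α ≅ reindex g α

record ElementaryExistential {o ℓ e p q} {𝒞 : Category o ℓ e} {FP : FiniteProducts 𝒞}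
       (D : Doctrine 𝒞 FP p q) : Set (o ⊔ ℓ ⊔ e ⊔ p ⊔ q) where
  open Category 𝒞
  open Doctrine D
  field
    ∃        : ∀ {A B} → Hom A B → P A → P B
    ∃⊣₁      : ∀ {A B} (f : Hom A B) {α : P A} {β : P B} → ∃ f α ≤ β → α ≤ reindex f β
    ∃⊣₂      : ∀ {A B} (f : Hom A B) {α : P A} {β : P B} → α ≤ reindex f β → ∃ f α ≤ β
    beck-chevalley : ∀ {A B C D} (f : Hom A B) (g : Hom C B) (p : Hom D A) (q : Hom D C) →
                     IsPullback 𝒞 f g p q → ∀ (α : P A) →
                     ∃ q (reindex p α) ≅ reindex g (∃ f α)
    frobenius : ∀ {A B} (f : Hom A B) (α : P A) (β : P B) →
                ∃ f (reindex f β ∧ α) ≅ β ∧ ∃ f α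

module Theory {o ℓ e p q} {𝒞 : Category o ℓ e} {FP : FiniteProducts 𝒞}
              {D : Doctrine 𝒞 FP p q} (E : ElementaryExistential D) where
  open Category 𝒞
  open FiniteProducts FP
  open Doctrine D
  open ElementaryExistential E

  δ : ∀ A → P (A ⊗ A)
  δ A = ∃ (Δ {A}) (top A)

  -- F ∈ P(Y × A) is a functional relation from Y to A:
  --   F(y,a) ∧ F(y,a') ≤ δ_A(a,a')   (in context Y × (A × A))
  --   ∃ a:A. F(y,a) = ⊤_Y
  Functional : ∀ {Y A} → P (Y ⊗ A) → Set q
  Functional {Y} {A} F =
    (reindex ⟨ π₁ , π₁ ∘ π₂ ⟩ F ∧ reindex ⟨ π₁ , π₂ ∘ π₂ ⟩ F
       ≤ reindex (π₂ {Y} {A ⊗ A}) (δ A))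
    × (∃ (π₁ {Y} {A}) F ≅ top Y)

  Γ : ∀ {Y A} → Hom Y A → P (Y ⊗ A)
  Γ {Y} {A} f = reindex (f ⁂ id) (δ A)

  -- composition in Map(𝒞,P):  (G ∘ F)(a,c) = ∃ b:B. F(a,b) ∧ G(b,c)
  -- computed in context (A × C) × B and quantified along π₁.
  compRel : ∀ {A B C} → P (A ⊗ B) → P (B ⊗ C) → P (A ⊗ C)
  compRel {A} {B} {C} F G =
    ∃ (π₁ {A ⊗ C} {B})
      (reindex ⟨ π₁ ∘ π₁ , π₂ ⟩ F ∧ reindex ⟨ π₂ , π₂ ∘ π₁ ⟩ G)

  Complete : Obj → Set (o ⊔ ℓ ⊔ e ⊔ p ⊔ q)
  Complete A =
    ∀ (Y : Obj) (F : P (Y ⊗ A)) → Functional F →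
      Σ[ f ∈ Hom Y A ] ((Γ f ≅ F) × (∀ (g : Hom Y A) → Γ g ≅ F → g ≈ f))

  InternallyBijective : ∀ {A B} → Hom A B → Set q
  InternallyBijective {A} {B} f =
    (δ A ≅ reindex (f ⁂ f) (δ B)) × (∃ f (top A) ≅ top B)

  IsSheaf : Obj → Set (o ⊔ ℓ ⊔ e ⊔ q)
  IsSheaf A =
    ∀ {X Y : Obj} (d : Hom X Y) (k : Hom X A) → InternallyBijective d →
      Σ[ h ∈ Hom Y A ] ((h ∘ d ≈ k) × (∀ (h' : Hom Y A) → h' ∘ d ≈ k → h' ≈ h))

  Comprehension : ∀ {A} → P A → Set (o ⊔ ℓ ⊔ e ⊔ q)
  Comprehension {A} α =
    Σ[ X ∈ Obj ] Σ[ c ∈ Hom X A ]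
      ((top X ≤ reindex c α) ×
       (∀ (Y : Obj) (f : Hom Y A) → top Y ≤ reindex f α →
          Σ[ g ∈ Hom Y X ] ((c ∘ g ≈ f) × (∀ (g' : Hom Y X) → c ∘ g' ≈ f → g' ≈ g))))

  HasImage : ∀ {X Y} → Hom X Y → Set (o ⊔ ℓ ⊔ e ⊔ q)
  HasImage {X} f = Comprehension (∃ f (top X))

  record PowerObjects : Set (o ⊔ ℓ ⊔ e ⊔ p ⊔ q) where
    field
      ℙ           : Obj → Obj
      ∈           : ∀ X → P (X ⊗ ℙ X)
      name         : ∀ {X Y} → P (X ⊗ Y) → Hom Y (ℙ X)
      name-spec     : ∀ {X Y} (γ : P (X ⊗ Y)) → γ ≅ reindex (id ⁂ (name (γ))) (∈ X)
      name-unique   : ∀ {X Y} (γ : P (X ⊗ Y)) (g : Hom Y (ℙ X)) →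
                    γ ≅ reindex (id ⁂ g) (∈ X) → g ≈ (name (γ))

  record Singletons : Set (o ⊔ ℓ ⊔ e ⊔ p ⊔ q) where
    field
      power : PowerObjects
    open PowerObjects power
    field
      singleton-image     : ∀ A → HasImage ((name (δ A)))
      singleton-injective : ∀ A → δ A ≅ reindex ((name (δ A)) ⁂ (name (δ A))) (δ (ℙ A))
      -- (id_A × g)* ∈_A, read as a relation from Y to A (i.e. reindexed
      -- along the symmetry Y × A → A × Y), is functional iff
      -- g*(∃_{⦃δ_A⦄} ⊤_A) = ⊤_Y
      singleton-functional :
        ∀ {Y A} (g : Hom Y (ℙ A)) →
          (Functional (reindex ⟨ π₂ , π₁ ⟩ (reindex (id ⁂ g) (∈ A)))
             → reindex g (∃ (name (δ A)) (top A)) ≅ top Y)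
          × (reindex g (∃ (name (δ A)) (top A)) ≅ top Y
             → Functional (reindex ⟨ π₂ , π₁ ⟩ (reindex (id ⁂ g) (∈ A))))

-- Category data, functors, natural isomorphisms, equivalences.
-- (Category *data*: the laws of Map_c(𝒞,P) are not needed to state that a
-- functor is an equivalence.)

record CatData (o ℓ e : Level) : Set (lsuc (o ⊔ ℓ ⊔ e)) where
  infix  4 _≈_
  infixr 9 _∘_
  field
    Obj : Set o
    Hom : Obj → Obj → Set ℓ
    _≈_ : ∀ {A B} → Hom A B → Hom A B → Set e
    id  : ∀ {A} → Hom A A
    _∘_ : ∀ {A B C} → Hom B C → Hom A B → Hom A C

record FunctorData {o ℓ e o' ℓ' e'} (𝒜 : CatData o ℓ e) (ℬ : CatData o' ℓ' e')
       : Set (o ⊔ ℓ ⊔ o' ⊔ ℓ') where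
  private
    module 𝒜 = CatData 𝒜
    module ℬ = CatData ℬ
  field
    F₀ : 𝒜.Obj → ℬ.Obj
    F₁ : ∀ {A B} → 𝒜.Hom A B → ℬ.Hom (F₀ A) (F₀ B)

module _ {o ℓ e o' ℓ' e'} {𝒜 : CatData o ℓ e} {ℬ : CatData o' ℓ' e'} where
  private
    module 𝒜 = CatData 𝒜
    module ℬ = CatData ℬ

  IsFunctor : FunctorData 𝒜 ℬ → Set (o ⊔ ℓ ⊔ e ⊔ e')
  IsFunctor F =
    (∀ {A B} {f g : 𝒜.Hom A B} → f 𝒜.≈ g → F₁ f ℬ.≈ F₁ g)
    × (∀ {A} → F₁ (𝒜.id {A}) ℬ.≈ ℬ.id)
    × (∀ {A B C} (f : 𝒜.Hom A B) (g : 𝒜.Hom B C) → F₁ (g 𝒜.∘ f) ℬ.≈ F₁ g ℬ.∘ F₁ f)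
    where open FunctorData F

  record NatIso (F G : FunctorData 𝒜 ℬ) : Set (o ⊔ ℓ ⊔ ℓ' ⊔ e') where
    private
      module F = FunctorData F
      module G = FunctorData G
    field
      η        : ∀ X → ℬ.Hom (F.F₀ X) (G.F₀ X)
      η⁻¹      : ∀ X → ℬ.Hom (G.F₀ X) (F.F₀ X)
      iso₁     : ∀ X → η⁻¹ X ℬ.∘ η X ℬ.≈ ℬ.id
      iso₂     : ∀ X → η X ℬ.∘ η⁻¹ X ℬ.≈ ℬ.id
      natural  : ∀ {X Y} (f : 𝒜.Hom X Y) → η Y ℬ.∘ F.F₁ f ℬ.≈ G.F₁ f ℬ.∘ η X

idF : ∀ {o ℓ e} {𝒜 : CatData o ℓ e} → FunctorData 𝒜 𝒜
idF = record { F₀ = λ A → A ; F₁ = λ f → f }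

_∘F_ : ∀ {o ℓ e o' ℓ' e' o'' ℓ'' e''} {𝒜 : CatData o ℓ e} {ℬ : CatData o' ℓ' e'}
         {𝒞 : CatData o'' ℓ'' e''} →
       FunctorData ℬ 𝒞 → FunctorData 𝒜 ℬ → FunctorData 𝒜 𝒞
G ∘F F = record { F₀ = λ A → G.F₀ (F.F₀ A) ; F₁ = λ f → G.F₁ (F.F₁ f) }
  where
    module F = FunctorData F
    module G = FunctorData G

IsEquivalenceFunctor : ∀ {o ℓ e o' ℓ' e'} {𝒜 : CatData o ℓ e} {ℬ : CatData o' ℓ' e'} →
                       FunctorData 𝒜 ℬ → Set (o ⊔ ℓ ⊔ e ⊔ o' ⊔ ℓ' ⊔ e')
IsEquivalenceFunctor {𝒜 = 𝒜} {ℬ = ℬ} U =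
  IsFunctor U ×
  (Σ[ V ∈ FunctorData ℬ 𝒜 ]
     (IsFunctor V × NatIso (V ∘F U) idF × NatIso (U ∘F V) idF))

module Categories {o ℓ e p q} {𝒞 : Category o ℓ e} {FP : FiniteProducts 𝒞}
                  {D : Doctrine 𝒞 FP p q} (E : ElementaryExistential D) where
  open Category 𝒞
  open FiniteProducts FP
  open Doctrine D
  open ElementaryExistential E
  open Theory E

  record MapStructure : Set (o ⊔ p ⊔ q) where
    field
      δ-functional : ∀ A → Functional (δ A)
      ∘-functional : ∀ {A B C} {F : P (A ⊗ B)} {G : P (B ⊗ C)} →
                     Functional F → Functional G → Functional (compRel F G)

  Mapc : MapStructure → CatData (o ⊔ ℓ ⊔ e ⊔ p ⊔ q) (p ⊔ q) q
  Mapc ms = record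
    { Obj = Σ[ A ∈ Obj ] Complete A
    ; Hom = λ X Y → Σ[ F ∈ P (proj₁ X ⊗ proj₁ Y) ] Functional F
    ; _≈_ = λ F G → proj₁ F ≅ proj₁ G
    ; id  = λ {X} → δ (proj₁ X) , MapStructure.δ-functional ms (proj₁ X)
    ; _∘_ = λ G F → compRel (proj₁ F) (proj₁ G) ,
                    MapStructure.∘-functional ms (proj₂ F) (proj₂ G)
    }

  Shv : CatData (o ⊔ ℓ ⊔ e ⊔ q) ℓ e
  Shv = record
    { Obj = Σ[ A ∈ Obj ] IsSheaf A
    ; Hom = λ X Y → Hom (proj₁ X) (proj₁ Y)
    ; _≈_ = _≈_
    ; id  = id
    ; _∘_ = _∘_
    }

  U : (ms : MapStructure) → (∀ {A} → Complete A → IsSheaf A) → FunctorData (Mapc ms) Shv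
  U ms cs = record
    { F₀ = λ X → proj₁ X , cs (proj₂ X)
    ; F₁ = λ {X} {Y} F → proj₁ (proj₂ Y (proj₁ X) (proj₁ F) (proj₂ F))
    }

module Submission where

-- From the axioms we derive the rules of
-- the quantifier ∃b (Beck–Chevalley gives substitution, Frobenius gives
-- elimination) and of the equality δ (reflexivity and Leibniz substitution,
-- hence symmetry, transitivity and congruence).  With these:
--   * functional relations compose and δ is functional (the MapStructure),
--     and the graph Γ is a functor 𝒞 → Map(𝒞,P);
--   * complete objects are sheaves: the extension of k along an internal
--     bijection d is the map whose graph is the functional relation Γk ∘ (Γd)°;
--   * with singletons, sheaves are complete: a sheaf A is isomorphic to the
--     image of its singleton map {δ_A}, and the name of the converse of a
--     functional relation into A factors through that image, yielding the
--     map whose graph the relation is.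
-- Finally V = Γ is a weak inverse of U: V ∘ U ≅ Id with components δ, and
-- U ∘ V ≅ Id with identity components.

open import Defs
open import Level using (Level)
open import Data.Product using (Σ-syntax; _,_; proj₁; proj₂)
open import Relation.Binary using (IsEquivalence)

module InternalLogic {o ℓ e p q} {𝒞 : Category o ℓ e} {FP : FiniteProducts 𝒞}
                     {D : Doctrine 𝒞 FP p q} (E : ElementaryExistential D) where
  open Category 𝒞
  open FiniteProducts FP
  open Doctrine D
  open ElementaryExistential E
  open Theory E
  open Categories E

  ≈-refl : ∀ {A B} {f : Hom A B} → f ≈ f
  ≈-refl = IsEquivalence.refl ≈-equiv

  ≈-sym : ∀ {A B} {f g : Hom A B} → f ≈ g → g ≈ f
  ≈-sym = IsEquivalence.sym ≈-equiv

  infixr 3 _∙≈_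
  _∙≈_ : ∀ {A B} {f g h : Hom A B} → f ≈ g → g ≈ h → f ≈ h
  _∙≈_ = IsEquivalence.trans ≈-equiv

  ∘-congˡ : ∀ {A B C} {f h : Hom B C} {g : Hom A B} → f ≈ h → f ∘ g ≈ h ∘ g
  ∘-congˡ p = ∘-resp-≈ p ≈-refl

  ∘-congʳ : ∀ {A B C} {f : Hom B C} {g i : Hom A B} → g ≈ i → f ∘ g ≈ f ∘ i
  ∘-congʳ p = ∘-resp-≈ ≈-refl p

  retraction-cancel : ∀ {A B C} {s : Hom A B} {r : Hom B A} {u v : Hom C A} →
                      r ∘ s ≈ id → s ∘ u ≈ s ∘ v → u ≈ v
  retraction-cancel rs e =
    ≈-sym identityˡ ∙≈ ∘-congˡ (≈-sym rs) ∙≈ assoc ∙≈ ∘-congʳ e ∙≈ ≈-sym assoc ∙≈ ∘-congˡ rs ∙≈ identityˡ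

  ⟨⟩-cong : ∀ {A B C} {f f' : Hom C A} {g g' : Hom C B} → f ≈ f' → g ≈ g' → ⟨ f , g ⟩ ≈ ⟨ f' , g' ⟩
  ⟨⟩-cong p q = ⟨⟩-unique (π₁-⟨⟩ ∙≈ p) (π₂-⟨⟩ ∙≈ q)

  ⟨⟩-∘ : ∀ {A B C X} {f : Hom C A} {g : Hom C B} {h : Hom X C} → ⟨ f , g ⟩ ∘ h ≈ ⟨ f ∘ h , g ∘ h ⟩
  ⟨⟩-∘ = ⟨⟩-unique (≈-sym assoc ∙≈ ∘-congˡ π₁-⟨⟩) (≈-sym assoc ∙≈ ∘-congˡ π₂-⟨⟩)

  ⟨π₁,π₂⟩≈id : ∀ {A B} → ⟨ π₁ {A} {B} , π₂ ⟩ ≈ id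
  ⟨π₁,π₂⟩≈id = ≈-sym (⟨⟩-unique identityʳ identityʳ)

  ⟨⟩-η : ∀ {A B C} {h : Hom C (A ⊗ B)} → h ≈ ⟨ π₁ ∘ h , π₂ ∘ h ⟩
  ⟨⟩-η = ⟨⟩-unique ≈-refl ≈-refl

  π₁-⁂ : ∀ {A B C D'} {f : Hom A B} {g : Hom C D'} → π₁ ∘ (f ⁂ g) ≈ f ∘ π₁
  π₁-⁂ = π₁-⟨⟩

  π₂-⁂ : ∀ {A B C D'} {f : Hom A B} {g : Hom C D'} → π₂ ∘ (f ⁂ g) ≈ g ∘ π₂
  π₂-⁂ = π₂-⟨⟩

  ⁂-⟨⟩ : ∀ {A B C D' X} {f : Hom A B} {g : Hom C D'} {h : Hom X A} {k : Hom X C} →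
         (f ⁂ g) ∘ ⟨ h , k ⟩ ≈ ⟨ f ∘ h , g ∘ k ⟩
  ⁂-⟨⟩ = ⟨⟩-∘ ∙≈ ⟨⟩-cong (assoc ∙≈ ∘-congʳ π₁-⟨⟩) (assoc ∙≈ ∘-congʳ π₂-⟨⟩)

  ⁂-∘-⁂ : ∀ {A B C A' B' C'} {f : Hom B C} {g : Hom B' C'} {f' : Hom A B} {g' : Hom A' B'} →
          (f ⁂ g) ∘ (f' ⁂ g') ≈ (f ∘ f') ⁂ (g ∘ g')
  ⁂-∘-⁂ = ⁂-⟨⟩ ∙≈ ⟨⟩-cong (≈-sym assoc) (≈-sym assoc)

  ⁂-cong : ∀ {A B C D'} {f f' : Hom A B} {g g' : Hom C D'} → f ≈ f' → g ≈ g' → f ⁂ g ≈ f' ⁂ g'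
  ⁂-cong p q = ⟨⟩-cong (∘-congˡ p) (∘-congˡ q)

  id⁂id : ∀ {A B} → id {A} ⁂ id {B} ≈ id
  id⁂id = ⟨⟩-cong identityˡ identityˡ ∙≈ ⟨π₁,π₂⟩≈id

  pullback-sym : ∀ {A B C D'} {f : Hom A B} {g : Hom C B} {p' : Hom D' A} {q' : Hom D' C} →
                 IsPullback 𝒞 f g p' q' → IsPullback 𝒞 g f q' p'
  pullback-sym (sq , univ) = ≈-sym sq , λ h k e →
    let (u , a , b , c) = univ k h (≈-sym e) in u , b , a , λ u' x y → c u' y x

  projection-pullback : ∀ {W W' B} (h : Hom W' W) → IsPullback 𝒞 (π₁ {W} {B}) h (h ⁂ id) π₁
  projection-pullback h = π₁-⁂ , λ u k e →
    ⟨ k , π₂ ∘ u ⟩ ,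
    (⁂-⟨⟩ ∙≈ ⟨⟩-cong (≈-sym e) identityˡ ∙≈ ≈-sym ⟨⟩-η) ,
    π₁-⟨⟩ ,
    λ u' x y → ⟨⟩-unique y (≈-sym identityˡ ∙≈ ≈-sym assoc ∙≈ ∘-congˡ (≈-sym π₂-⁂) ∙≈ assoc ∙≈ ∘-congʳ x)

  infixr 3 _∙≤_ _∙≅_
  _∙≤_ : ∀ {A} {α β γ : P A} → α ≤ β → β ≤ γ → α ≤ γ
  _∙≤_ = ≤-trans

  ≅-refl : ∀ {A} {α : P A} → α ≅ α
  ≅-refl = ≤-refl , ≤-refl

  ≅-sym : ∀ {A} {α β : P A} → α ≅ β → β ≅ α
  ≅-sym (a , b) = b , a

  _∙≅_ : ∀ {A} {α β γ : P A} → α ≅ β → β ≅ γ → α ≅ γ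
  (a , b) ∙≅ (c , d) = ≤-trans a c , ≤-trans d b

  ∧-mono : ∀ {A} {α α' β β' : P A} → α ≤ α' → β ≤ β' → α ∧ β ≤ α' ∧ β'
  ∧-mono p q = ∧-glb (∧-lb₁ ∙≤ p) (∧-lb₂ ∙≤ q)

  ∧-cong : ∀ {A} {α α' β β' : P A} → α ≅ α' → β ≅ β' → α ∧ β ≅ α' ∧ β'
  ∧-cong p q = ∧-mono (proj₁ p) (proj₁ q) , ∧-mono (proj₂ p) (proj₂ q)

  ∧-comm : ∀ {A} {α β : P A} → α ∧ β ≤ β ∧ α
  ∧-comm = ∧-glb ∧-lb₂ ∧-lb₁

  reindex-cong : ∀ {A B} (f : Hom A B) {α β : P B} → α ≅ β → reindex f α ≅ reindex f β
  reindex-cong f (a , b) = reindex-mono f a , reindex-mono f b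

  top≤reindex-top : ∀ {A B} (f : Hom A B) → top A ≤ reindex f (top B)
  top≤reindex-top f = proj₂ (reindex-top f)

  ∃-unit : ∀ {A B} (f : Hom A B) {α : P A} → α ≤ reindex f (∃ f α)
  ∃-unit f = ∃⊣₁ f ≤-refl

  ∃-mono : ∀ {A B} (f : Hom A B) {α β : P A} → α ≤ β → ∃ f α ≤ ∃ f β
  ∃-mono f p = ∃⊣₂ f (p ∙≤ ∃-unit f)

  ∃-cong : ∀ {A B} (f : Hom A B) {α β : P A} → α ≅ β → ∃ f α ≅ ∃ f β
  ∃-cong f (a , b) = ∃-mono f a , ∃-mono f b

  ∃-resp : ∀ {A B} {f g : Hom A B} → f ≈ g → ∀ {α} → ∃ f α ≅ ∃ g α
  ∃-resp {f = f} {g} e = ∃⊣₂ f (∃-unit g ∙≤ proj₁ (reindex-resp (≈-sym e))) ,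
                         ∃⊣₂ g (∃-unit f ∙≤ proj₁ (reindex-resp e))

  ∃-∘ : ∀ {A B C} (f : Hom A B) (g : Hom B C) {α : P A} → ∃ (g ∘ f) α ≅ ∃ g (∃ f α)
  ∃-∘ f g = ∃⊣₂ (g ∘ f) (∃-unit f ∙≤ reindex-mono f (∃-unit g) ∙≤ proj₂ (reindex-∘ f g)) ,
            ∃⊣₂ g (∃⊣₂ f (∃-unit (g ∘ f) ∙≤ proj₁ (reindex-∘ f g)))

  ∃-id : ∀ {A} {α : P A} → ∃ id α ≅ α
  ∃-id = ∃⊣₂ id (proj₂ reindex-id) , (∃-unit id ∙≤ proj₁ reindex-id)

  ∃-witness : ∀ {W X Y} (m : Hom W X) (f : Hom X Y) {k : Hom W Y} → f ∘ m ≈ k → ∀ {φ} →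
              reindex m φ ≤ reindex k (∃ f φ)
  ∃-witness m f e = reindex-mono m (∃-unit f) ∙≤ proj₂ (reindex-∘ m f) ∙≤ proj₁ (reindex-resp e)

  at : ∀ {W A B} → P (A ⊗ B) → Hom W A → Hom W B → P W
  at R t u = reindex ⟨ t , u ⟩ R

  at-cong : ∀ {W A B} {R : P (A ⊗ B)} {t t' : Hom W A} {u u' : Hom W B} →
            t ≈ t' → u ≈ u' → at R t u ≅ at R t' u'
  at-cong p q = reindex-resp (⟨⟩-cong p q)

  at-∘ : ∀ {V W A B} {R : P (A ⊗ B)} {t : Hom W A} {u : Hom W B} (h : Hom V W) →
         reindex h (at R t u) ≅ at R (t ∘ h) (u ∘ h)
  at-∘ {t = t} {u} h = ≅-sym (reindex-∘ h ⟨ t , u ⟩) ∙≅ reindex-resp ⟨⟩-∘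

  at-η : ∀ {W A B} {R : P (A ⊗ B)} (m : Hom W (A ⊗ B)) → reindex m R ≅ at R (π₁ ∘ m) (π₂ ∘ m)
  at-η m = reindex-resp ⟨⟩-η

  at-⁂ : ∀ {W A B A' B'} {R : P (A ⊗ B)} {f : Hom A' A} {g : Hom B' B} {t : Hom W A'} {u : Hom W B'} →
         at (reindex (f ⁂ g) R) t u ≅ at R (f ∘ t) (g ∘ u)
  at-⁂ {f = f} {g} {t} {u} = ≅-sym (reindex-∘ ⟨ t , u ⟩ (f ⁂ g)) ∙≅ reindex-resp ⁂-⟨⟩

  at-π : ∀ {A B} {R : P (A ⊗ B)} → at R π₁ π₂ ≅ R
  at-π = reindex-resp ⟨π₁,π₂⟩≈id ∙≅ reindex-id

  ≅-from-generic : ∀ {A B} {R S : P (A ⊗ B)} → at R π₁ π₂ ≅ at S π₁ π₂ → R ≅ S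
  ≅-from-generic h = ≅-sym at-π ∙≅ h ∙≅ at-π

  converse : ∀ {A B} → P (A ⊗ B) → P (B ⊗ A)
  converse R = reindex ⟨ π₂ , π₁ ⟩ R

  at-converse : ∀ {W A B} {R : P (A ⊗ B)} {t : Hom W A} {u : Hom W B} →
                at (converse R) u t ≅ at R t u
  at-converse {t = t} {u} =
    ≅-sym (reindex-∘ ⟨ u , t ⟩ ⟨ π₂ , π₁ ⟩) ∙≅ reindex-resp (⟨⟩-∘ ∙≈ ⟨⟩-cong π₂-⟨⟩ π₁-⟨⟩)

  converse-involutive : ∀ {A B} {R : P (A ⊗ B)} → converse (converse R) ≅ R
  converse-involutive = ≅-from-generic (at-converse ∙≅ at-converse)

  Exists : ∀ {W B} → P (W ⊗ B) → P W
  Exists = ∃ π₁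

  Exists-subst : ∀ {W W' B} (h : Hom W' W) {φ : P (W ⊗ B)} →
                 reindex h (Exists φ) ≅ Exists (reindex (h ⁂ id) φ)
  Exists-subst h {φ} = ≅-sym (beck-chevalley π₁ h (h ⁂ id) π₁ (projection-pullback h) φ)

  Exists-intro : ∀ {W B} (t : Hom W B) {φ : P (W ⊗ B)} → reindex ⟨ id , t ⟩ φ ≤ Exists φ
  Exists-intro t = ∃-witness ⟨ id , t ⟩ π₁ π₁-⟨⟩ ∙≤ proj₁ reindex-id

  Exists-elim : ∀ {W B} {β ψ : P W} {φ : P (W ⊗ B)} →
                reindex π₁ β ∧ φ ≤ reindex π₁ ψ → β ∧ Exists φ ≤ ψ
  Exists-elim {β = β} {φ = φ} h = proj₂ (frobenius π₁ φ β) ∙≤ ∃⊣₂ π₁ h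

  -- eliminating two quantifiers at once, with witnesses b (inner) and b' (outer)
  Exists-elim₂ : ∀ {W B} {φ φ' : P (W ⊗ B)} {ψ : P W} →
                 reindex π₁ φ ∧ reindex (π₁ ⁂ id) φ' ≤ reindex (π₁ ∘ π₁) ψ → Exists φ ∧ Exists φ' ≤ ψ
  Exists-elim₂ h =
    ∧-comm ∙≤ Exists-elim (∧-mono (proj₁ (Exists-subst π₁)) ≤-refl ∙≤ ∧-comm ∙≤
                           Exists-elim (h ∙≤ proj₁ (reindex-∘ π₁ π₁)))

  Exists-mono : ∀ {W B} {φ ψ : P (W ⊗ B)} → φ ≤ ψ → Exists φ ≤ Exists ψ
  Exists-mono = ∃-mono π₁

  δ-refl : ∀ {W A} (t : Hom W A) → top W ≤ at (δ A) t t
  δ-refl t = top≤reindex-top t ∙≤ ∃-witness t Δ (⟨⟩-∘ ∙≈ ⟨⟩-cong identityˡ identityˡ)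

  δ-≈ : ∀ {W A} {t t' : Hom W A} → t ≈ t' → top W ≤ at (δ A) t t'
  δ-≈ {t = t} e = δ-refl t ∙≤ proj₁ (at-cong ≈-refl e)

  δ-subst-generic : ∀ {A B} (γ : P (A ⊗ B)) →
                    reindex π₁ (δ A) ∧ at γ (π₁ ∘ π₁) π₂ ≤ at γ (π₂ ∘ π₁) π₂
  δ-subst-generic {A} {B} γ =
    ∧-mono (proj₂ δ-along-π₁) ≤-refl ∙≤ ∧-comm ∙≤
    proj₂ (frobenius m (reindex π₁ (top A)) (at γ (π₁ ∘ π₁) π₂)) ∙≤
    ∃⊣₂ m (∧-lb₁ ∙≤ proj₁ (at-∘ m ∙≅ at-cong e₁ e₃) ∙≤ proj₂ (at-∘ m ∙≅ at-cong e₂ e₃))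
    where
      m : Hom (A ⊗ B) ((A ⊗ A) ⊗ B)
      m = Δ ⁂ id
      δ-along-π₁ : ∃ m (reindex π₁ (top A)) ≅ reindex π₁ (δ A)
      δ-along-π₁ = beck-chevalley Δ π₁ π₁ m (pullback-sym (projection-pullback Δ)) (top A)
      e₁ : (π₁ ∘ π₁) ∘ m ≈ π₁
      e₁ = assoc ∙≈ ∘-congʳ π₁-⁂ ∙≈ ≈-sym assoc ∙≈ ∘-congˡ π₁-⟨⟩ ∙≈ identityˡ
      e₂ : (π₂ ∘ π₁) ∘ m ≈ π₁
      e₂ = assoc ∙≈ ∘-congʳ π₁-⁂ ∙≈ ≈-sym assoc ∙≈ ∘-congˡ π₂-⟨⟩ ∙≈ identityˡ
      e₃ : π₂ ∘ m ≈ π₂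
      e₃ = π₂-⁂ ∙≈ identityˡ

  δ-subst : ∀ {W A B} (γ : P (A ⊗ B)) (t t' : Hom W A) (u : Hom W B) →
            at (δ A) t t' ∧ at γ t u ≤ at γ t' u
  δ-subst γ t t' u =
    proj₂ (reindex-∧ m ∙≅ ∧-cong (≅-sym (reindex-∘ m π₁) ∙≅ reindex-resp π₁-⟨⟩) (at-∘ m ∙≅ at-cong e₁ π₂-⟨⟩)) ∙≤
    reindex-mono m (δ-subst-generic γ) ∙≤ proj₁ (at-∘ m ∙≅ at-cong e₂ π₂-⟨⟩)
    where
      m = ⟨ ⟨ t , t' ⟩ , u ⟩
      e₁ : (π₁ ∘ π₁) ∘ m ≈ t
      e₁ = assoc ∙≈ ∘-congʳ π₁-⟨⟩ ∙≈ π₁-⟨⟩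
      e₂ : (π₂ ∘ π₁) ∘ m ≈ t'
      e₂ = assoc ∙≈ ∘-congʳ π₁-⟨⟩ ∙≈ π₂-⟨⟩

  δ-subst₂ : ∀ {W A B} (γ : P (A ⊗ B)) (t : Hom W A) (u u' : Hom W B) →
             at (δ B) u u' ∧ at γ t u ≤ at γ t u'
  δ-subst₂ γ t u u' =
    ∧-mono ≤-refl (proj₂ at-converse) ∙≤ δ-subst (converse γ) u u' t ∙≤ proj₁ at-converse

  δ-subst-pred : ∀ {W A} (β : P A) (t t' : Hom W A) → at (δ A) t t' ∧ reindex t β ≤ reindex t' β
  δ-subst-pred β t t' = ∧-mono ≤-refl (proj₂ (β-at t)) ∙≤ δ-subst (reindex π₁ β) t t' t ∙≤ proj₁ (β-at t')
    where
      β-at : ∀ s → at (reindex π₁ β) s t ≅ reindex s β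
      β-at s = ≅-sym (reindex-∘ ⟨ s , t ⟩ π₁) ∙≅ reindex-resp π₁-⟨⟩

  δ-sym : ∀ {W A} (t t' : Hom W A) → at (δ A) t t' ≤ at (δ A) t' t
  δ-sym t t' = ∧-glb ≤-refl (top-max ∙≤ δ-refl t) ∙≤ δ-subst (δ _) t t' t

  δ-trans : ∀ {W A} (t t' t'' : Hom W A) → at (δ A) t t' ∧ at (δ A) t' t'' ≤ at (δ A) t t''
  δ-trans t t' t'' = ∧-comm ∙≤ δ-subst₂ (δ _) t t' t''

  δ-cong : ∀ {W A B} (k : Hom A B) (t t' : Hom W A) → at (δ A) t t' ≤ at (δ B) (k ∘ t) (k ∘ t')
  δ-cong k t t' = ∧-glb ≤-refl (top-max ∙≤ δ-refl (k ∘ t) ∙≤ proj₂ at-⁂) ∙≤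
                  δ-subst₂ (reindex (k ⁂ k) (δ _)) t t t' ∙≤ proj₁ at-⁂

  δ-preserved : ∀ {A B} (f : Hom A B) → δ A ≤ reindex (f ⁂ f) (δ B)
  δ-preserved f = ∃⊣₂ Δ (δ-refl (f ∘ id) ∙≤ proj₂ at-⁂)

  ∃-via-Exists : ∀ {X Z} (f : Hom X Z) (α : P X) →
                 ∃ f α ≅ Exists (reindex π₂ α ∧ at (δ Z) (f ∘ π₂) π₁)
  ∃-via-Exists f α =
    ∃⊣₂ f (∧-glb (proj₂ α-at) (top-max ∙≤ δ-refl f ∙≤ proj₂ δ-at) ∙≤ proj₂ (reindex-∧ ⟨ f , id ⟩) ∙≤
           ∃-witness ⟨ f , id ⟩ π₁ π₁-⟨⟩) ,
    ∃⊣₂ π₁ (∧-mono (reindex-mono π₂ (∃-unit f) ∙≤ proj₂ (reindex-∘ π₂ f)) ≤-refl ∙≤ ∧-comm ∙≤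
            δ-subst-pred (∃ f α) (f ∘ π₂) π₁)
    where
      α-at : reindex ⟨ f , id ⟩ (reindex π₂ α) ≅ α
      α-at = ≅-sym (reindex-∘ ⟨ f , id ⟩ π₂) ∙≅ reindex-resp π₂-⟨⟩ ∙≅ reindex-id
      δ-at : reindex ⟨ f , id ⟩ (at (δ _) (f ∘ π₂) π₁) ≅ at (δ _) f f
      δ-at = at-∘ ⟨ f , id ⟩ ∙≅ at-cong (assoc ∙≈ ∘-congʳ π₂-⟨⟩ ∙≈ identityʳ) π₁-⟨⟩

  InternallyInjective : ∀ {X Y} → Hom X Y → Set q
  InternallyInjective {X} {Y} d = δ X ≅ reindex (d ⁂ d) (δ Y)

  InternallySurjective : ∀ {X Y} → Hom X Y → Set q
  InternallySurjective {X} {Y} d = ∃ d (top X) ≅ top Y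

  injective-at : ∀ {W X Y} {d : Hom X Y} → InternallyInjective d → (x x' : Hom W X) →
                 at (δ Y) (d ∘ x) (d ∘ x') ≤ at (δ X) x x'
  injective-at inj x x' = proj₂ at-⁂ ∙≤ reindex-mono ⟨ x , x' ⟩ (proj₂ inj)

  surjective-at : ∀ {W X Y} {d : Hom X Y} → InternallySurjective d → (t : Hom W Y) →
                  top W ≤ Exists {W} {X} (at (δ Y) (d ∘ π₂) (t ∘ π₁))
  surjective-at {X = X} {d = d} surj t =
    top≤reindex-top t ∙≤ reindex-mono t (proj₂ surj ∙≤ proj₁ (∃-via-Exists d (top X))) ∙≤
    proj₁ (Exists-subst t) ∙≤
    Exists-mono (proj₁ (reindex-∧ _) ∙≤ ∧-lb₂ ∙≤ proj₁ (at-∘ _ ∙≅ at-cong d-term π₁-⁂))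
    where
      d-term : (d ∘ π₂) ∘ (t ⁂ id) ≈ d ∘ π₂
      d-term = assoc ∙≈ ∘-congʳ (π₂-⁂ ∙≈ identityˡ)

  injective-cancel : ∀ {X Y Z} {f' : Hom X Y} {c : Hom Y Z} {f : Hom X Z} →
                     c ∘ f' ≈ f → InternallyInjective f → InternallyInjective f'
  injective-cancel {f' = f'} {c} e inj =
    δ-preserved f' ,
    (reindex-mono (f' ⁂ f') (δ-preserved c) ∙≤ proj₂ (reindex-∘ (f' ⁂ f') (c ⁂ c)) ∙≤
     proj₁ (reindex-resp (⁂-∘-⁂ ∙≈ ⁂-cong e e)) ∙≤ proj₂ inj)

  surjective-reflects-≤ : ∀ {W Z X} (e : Hom X Z) → InternallySurjective e → {α β : P (W ⊗ Z)} →
                          reindex (id ⁂ e) α ≤ reindex (id ⁂ e) β → α ≤ β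
  surjective-reflects-≤ {W} {Z} e surj {α} {β} hyp =
    ∧-glb ≤-refl (top-max ∙≤ surjective-at surj π₂) ∙≤
    Exists-elim (∧-glb ∧-lb₂ (∧-glb (∧-lb₂ ∙≤ δ-sym _ _) (∧-lb₁ ∙≤ proj₁ (at-η π₁)) ∙≤
                              δ-subst₂ α _ _ _ ∙≤ proj₁ along-e ∙≤ reindex-mono _ hyp ∙≤ proj₂ along-e) ∙≤
                 δ-subst₂ β _ _ _ ∙≤ proj₂ (at-η π₁))
    where
      along-e : ∀ {R : P (W ⊗ Z)} → at R (π₁ ∘ π₁) (e ∘ π₂) ≅ at (reindex (id ⁂ e) R) (π₁ ∘ π₁) π₂
      along-e = at-cong (≈-sym identityˡ) ≈-refl ∙≅ ≅-sym at-⁂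

  single-valued-at : ∀ {W Y A} {F : P (Y ⊗ A)} → Functional F → (t : Hom W Y) (u u' : Hom W A) →
                     at F t u ∧ at F t u' ≤ at (δ A) u u'
  single-valued-at (sv , _) t u u' =
    proj₂ (reindex-∧ m ∙≅ ∧-cong (at-∘ m ∙≅ at-cong π₁-⟨⟩ e₁) (at-∘ m ∙≅ at-cong π₁-⟨⟩ e₂)) ∙≤
    reindex-mono m sv ∙≤ proj₁ (≅-sym (reindex-∘ m π₂) ∙≅ reindex-resp π₂-⟨⟩)
    where
      m = ⟨ t , ⟨ u , u' ⟩ ⟩
      e₁ : (π₁ ∘ π₂) ∘ m ≈ u
      e₁ = assoc ∙≈ ∘-congʳ π₂-⟨⟩ ∙≈ π₁-⟨⟩
      e₂ : (π₂ ∘ π₂) ∘ m ≈ u'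
      e₂ = assoc ∙≈ ∘-congʳ π₂-⟨⟩ ∙≈ π₂-⟨⟩

  total-at : ∀ {W Y A} {F : P (Y ⊗ A)} → Functional F → (t : Hom W Y) →
             top W ≤ Exists (at F (t ∘ π₁) π₂)
  total-at (_ , tot) t =
    top≤reindex-top t ∙≤ reindex-mono t (proj₂ tot) ∙≤ proj₁ (Exists-subst t) ∙≤
    Exists-mono (proj₁ (at-cong ≈-refl identityˡ))

  functional-intro : ∀ {Y A} {F : P (Y ⊗ A)} →
                     at F π₁ (π₁ ∘ π₂) ∧ at F π₁ (π₂ ∘ π₂) ≤ at (δ A) (π₁ ∘ π₂) (π₂ ∘ π₂) →
                     top Y ≤ Exists F → Functional F
  functional-intro sv tot = (sv ∙≤ proj₂ (at-η π₂)) , (top-max , tot)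

  functional-resp : ∀ {Y A} {F G : P (Y ⊗ A)} → F ≅ G → Functional F → Functional G
  functional-resp e (sv , tot) =
    (∧-mono (reindex-mono _ (proj₂ e)) (reindex-mono _ (proj₂ e)) ∙≤ sv) ,
    (top-max , (proj₂ tot ∙≤ ∃-mono π₁ (proj₁ e)))

  compRel-at : ∀ {W A B C} {F : P (A ⊗ B)} {G : P (B ⊗ C)} (t : Hom W A) (u : Hom W C) →
               at (compRel F G) t u ≅ Exists (at F (t ∘ π₁) π₂ ∧ at G π₂ (u ∘ π₁))
  compRel-at t u =
    Exists-subst ⟨ t , u ⟩ ∙≅
    ∃-cong π₁ (reindex-∧ h ∙≅ ∧-cong (at-∘ h ∙≅ at-cong e₁ e₂) (at-∘ h ∙≅ at-cong e₂ e₃))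
    where
      h = ⟨ t , u ⟩ ⁂ id
      e₁ : (π₁ ∘ π₁) ∘ h ≈ t ∘ π₁
      e₁ = assoc ∙≈ ∘-congʳ π₁-⁂ ∙≈ ≈-sym assoc ∙≈ ∘-congˡ π₁-⟨⟩
      e₂ : π₂ ∘ h ≈ π₂
      e₂ = π₂-⁂ ∙≈ identityˡ
      e₃ : (π₂ ∘ π₁) ∘ h ≈ u ∘ π₁
      e₃ = assoc ∙≈ ∘-congʳ π₁-⁂ ∙≈ ≈-sym assoc ∙≈ ∘-congˡ π₂-⟨⟩

  compRel-intro : ∀ {W A B C} {F : P (A ⊗ B)} {G : P (B ⊗ C)} (t : Hom W A) (b : Hom W B) (u : Hom W C) →
                  at F t b ∧ at G b u ≤ at (compRel F G) t u
  compRel-intro t b u =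
    proj₂ (reindex-∧ ⟨ id , b ⟩ ∙≅ ∧-cong (at-∘ _ ∙≅ at-cong e₁ π₂-⟨⟩) (at-∘ _ ∙≅ at-cong π₂-⟨⟩ e₂)) ∙≤
    Exists-intro b ∙≤ proj₂ (compRel-at t u)
    where
      e₁ : (t ∘ π₁) ∘ ⟨ id , b ⟩ ≈ t
      e₁ = assoc ∙≈ ∘-congʳ π₁-⟨⟩ ∙≈ identityʳ
      e₂ : (u ∘ π₁) ∘ ⟨ id , b ⟩ ≈ u
      e₂ = assoc ∙≈ ∘-congʳ π₁-⟨⟩ ∙≈ identityʳ

  compRel-elim : ∀ {W A B C} {F : P (A ⊗ B)} {G : P (B ⊗ C)} (t : Hom W A) (u : Hom W C) {ψ : P W} →
                 at F (t ∘ π₁) π₂ ∧ at G π₂ (u ∘ π₁) ≤ reindex π₁ ψ → at (compRel F G) t u ≤ ψ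
  compRel-elim t u h = proj₁ (compRel-at t u) ∙≤ ∧-glb top-max ≤-refl ∙≤ Exists-elim (∧-lb₂ ∙≤ h)

  compRel-resp : ∀ {A B C} {F F' : P (A ⊗ B)} {G G' : P (B ⊗ C)} → F ≅ F' → G ≅ G' →
                 compRel F G ≅ compRel F' G'
  compRel-resp e₁ e₂ = ∃-cong π₁ (∧-cong (reindex-cong _ e₁) (reindex-cong _ e₂))

  compRel-idʳ : ∀ {A B} {F : P (A ⊗ B)} → compRel F (δ B) ≅ F
  compRel-idʳ {F = F} = ≅-from-generic
    (compRel-elim π₁ π₂ (∧-comm ∙≤ δ-subst₂ F (π₁ ∘ π₁) π₂ (π₂ ∘ π₁) ∙≤ proj₂ (at-∘ π₁)) ,
     (∧-glb ≤-refl (top-max ∙≤ δ-refl π₂) ∙≤ compRel-intro π₁ π₂ π₂))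

  compRel-idˡ : ∀ {A B} {F : P (A ⊗ B)} → compRel (δ A) F ≅ F
  compRel-idˡ {F = F} = ≅-from-generic
    (compRel-elim π₁ π₂ (∧-mono (δ-sym (π₁ ∘ π₁) π₂) ≤-refl ∙≤
                         δ-subst F π₂ (π₁ ∘ π₁) (π₂ ∘ π₁) ∙≤ proj₂ (at-∘ π₁)) ,
     (∧-glb (top-max ∙≤ δ-refl π₁) ≤-refl ∙≤ compRel-intro π₁ π₁ π₂))

  δ-functional : ∀ A → Functional (δ A)
  δ-functional A =
    functional-intro (∧-mono (δ-sym π₁ (π₁ ∘ π₂)) ≤-refl ∙≤ δ-trans (π₁ ∘ π₂) π₁ (π₂ ∘ π₂))
                     (δ-refl id ∙≤ Exists-intro id)

  composite-single-valued : ∀ {V A B C} {F : P (A ⊗ B)} {G : P (B ⊗ C)} → Functional F → Functional G →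
                            (y : Hom V A) (b b' : Hom V B) (c c' : Hom V C) →
                            (at F y b ∧ at G b c) ∧ (at F y b' ∧ at G b' c') ≤ at (δ C) c c'
  composite-single-valued {G = G} fF fG y b b' c c' =
    ∧-glb (∧-glb (∧-glb (∧-lb₁ ∙≤ ∧-lb₁) (∧-lb₂ ∙≤ ∧-lb₁) ∙≤ single-valued-at fF y b b') (∧-lb₁ ∙≤ ∧-lb₂) ∙≤
           δ-subst G b b' c)
          (∧-lb₂ ∙≤ ∧-lb₂) ∙≤
    single-valued-at fG b' c c'

  compRel-functional : ∀ {A B C} {F : P (A ⊗ B)} {G : P (B ⊗ C)} →
                       Functional F → Functional G → Functional (compRel F G)
  compRel-functional {A} {B} {C} {F} {G} fF fG = functional-intro single-valued total
    where
      GF = compRel F G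
      -- for y, pick b with F(y,b), then c with G(b,c)
      total : top A ≤ Exists GF
      total = proj₂ (proj₂ fF) ∙≤
              ∃⊣₂ π₁ (∧-glb ≤-refl (top-max ∙≤ total-at fG π₂) ∙≤
                      Exists-elim (∧-mono (proj₁ (at-η π₁)) ≤-refl ∙≤ compRel-intro _ _ _ ∙≤
                                   ∃-witness ⟨ π₁ ∘ π₁ , π₂ ⟩ π₁ π₁-⟨⟩ ∙≤ proj₁ (reindex-∘ π₁ π₁)))
      e₁ : ∀ {X} {z : Hom (A ⊗ (C ⊗ C)) X} → (z ∘ π₁) ∘ (π₁ {A ⊗ (C ⊗ C)} {B} ⁂ id {B}) ≈ z ∘ (π₁ ∘ π₁)
      e₁ = assoc ∙≈ ∘-congʳ π₁-⁂
      e₂ : π₂ ∘ (π₁ {A ⊗ (C ⊗ C)} {B} ⁂ id {B}) ≈ π₂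
      e₂ = π₂-⁂ ∙≈ identityˡ
      single-valued : at GF π₁ (π₁ ∘ π₂) ∧ at GF π₁ (π₂ ∘ π₂) ≤ at (δ C) (π₁ ∘ π₂) (π₂ ∘ π₂)
      single-valued =
        ∧-mono (proj₁ (compRel-at _ _)) (proj₁ (compRel-at _ _)) ∙≤
        Exists-elim₂
          (∧-mono (proj₁ (reindex-∧ π₁ ∙≅ ∧-cong (at-∘ π₁ ∙≅ at-cong assoc ≈-refl) (at-∘ π₁ ∙≅ at-cong ≈-refl assoc)))
                  (proj₁ (reindex-∧ (π₁ ⁂ id) ∙≅ ∧-cong (at-∘ _ ∙≅ at-cong e₁ e₂) (at-∘ _ ∙≅ at-cong e₂ e₁))) ∙≤
           composite-single-valued fF fG _ _ _ _ _ ∙≤ proj₂ (at-∘ (π₁ ∘ π₁)))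

  mapStructure : MapStructure
  mapStructure = record { δ-functional = δ-functional ; ∘-functional = compRel-functional }

  Γ-at : ∀ {W Y A} (f : Hom Y A) (t : Hom W Y) (u : Hom W A) → at (Γ f) t u ≅ at (δ A) (f ∘ t) u
  Γ-at f t u = at-⁂ ∙≅ at-cong ≈-refl identityˡ

  Γ-functional : ∀ {Y A} (f : Hom Y A) → Functional (Γ f)
  Γ-functional f =
    functional-intro (∧-mono (proj₁ (Γ-at f _ _)) (proj₁ (Γ-at f _ _)) ∙≤
                      ∧-mono (δ-sym (f ∘ π₁) (π₁ ∘ π₂)) ≤-refl ∙≤ δ-trans _ _ _)
                     (δ-≈ identityʳ ∙≤ proj₂ (Γ-at f id f) ∙≤ Exists-intro f)

  Γ-resp : ∀ {Y A} {f g : Hom Y A} → f ≈ g → Γ f ≅ Γ g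
  Γ-resp e = reindex-resp (⁂-cong e ≈-refl)

  Γ-id : ∀ {A} → Γ (id {A}) ≅ δ A
  Γ-id = reindex-resp id⁂id ∙≅ reindex-id

  Γ-∘ : ∀ {A B C} (f : Hom A B) (g : Hom B C) → compRel (Γ f) (Γ g) ≅ Γ (g ∘ f)
  Γ-∘ f g = ≅-from-generic
    (compRel-elim π₁ π₂ (∧-mono (proj₁ (Γ-at f _ _)) (proj₁ (Γ-at g _ _)) ∙≤
                         ∧-mono (δ-cong g _ _) ≤-refl ∙≤ δ-trans _ _ _ ∙≤
                         proj₁ (at-cong (≈-sym assoc) ≈-refl) ∙≤ proj₂ (at-∘ π₁ ∙≅ Γ-at (g ∘ f) _ _)) ,
     (proj₁ (Γ-at (g ∘ f) π₁ π₂) ∙≤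
      ∧-glb (top-max ∙≤ δ-refl (f ∘ π₁)) (proj₁ (at-cong assoc ≈-refl)) ∙≤
      ∧-mono (proj₂ (Γ-at f _ _)) (proj₂ (Γ-at g _ _)) ∙≤ compRel-intro π₁ (f ∘ π₁) π₂))

  Γ°-at : ∀ {W Y A} (f : Hom Y A) (t : Hom W A) (u : Hom W Y) →
          at (converse (Γ f)) t u ≅ at (δ A) (f ∘ u) t
  Γ°-at f t u = at-converse ∙≅ Γ-at f u t

  δ-along-graph : ∀ {Y A} (f : Hom Y A) → reindex (id ⁂ f) (δ A) ≅ converse (Γ f)
  δ-along-graph f = ≅-from-generic
    (at-⁂ ∙≅ at-cong identityˡ ≈-refl ∙≅ (δ-sym _ _ , δ-sym _ _) ∙≅ ≅-sym (Γ°-at f π₁ π₂))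

  complete-Γ-injective : ∀ {Y A} → Complete A → {f g : Hom Y A} → Γ f ≅ Γ g → f ≈ g
  complete-Γ-injective {Y} cA {f} {g} e =
    let (_ , _ , unique) = cA Y (Γ g) (Γ-functional g) in unique f e ∙≈ ≈-sym (unique g ≅-refl)

  -- For an internal bijection d : X → Y the
  -- converse of its graph is functional, so for k : X → A the relation
  --   Ext = Γk ∘ (Γd)°,   Ext(y,a) ⟺ ∃x. d(x) = y ∧ k(x) = a,
  -- is functional; the map with graph Ext is the extension of k along d.
  converse-graph-functional : ∀ {X Y} {d : Hom X Y} → InternallyBijective d → Functional (converse (Γ d))
  converse-graph-functional {d = d} (inj , surj) =
    functional-intro
      (∧-mono (proj₁ (Γ°-at d _ _)) (proj₁ (Γ°-at d _ _) ∙≤ δ-sym _ _) ∙≤ δ-trans _ _ _ ∙≤ injective-at inj _ _)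
      (surjective-at surj id ∙≤
       Exists-mono (proj₁ (at-cong ≈-refl identityˡ) ∙≤ proj₂ (Γ°-at d π₁ π₂) ∙≤ proj₁ at-π))

  module SheafExtension {A X Y} (d : Hom X Y) (k : Hom X A) (bij : InternallyBijective d) where
    Ext : P (Y ⊗ A)
    Ext = compRel (converse (Γ d)) (Γ k)

    Ext-functional : Functional Ext
    Ext-functional = compRel-functional (converse-graph-functional bij) (Γ-functional k)

    Ext-intro : ∀ {W} (x : Hom W X) (t : Hom W Y) (u : Hom W A) →
                at (δ Y) (d ∘ x) t ∧ at (δ A) (k ∘ x) u ≤ at Ext t u
    Ext-intro x t u = ∧-mono (proj₂ (Γ°-at d t x)) (proj₂ (Γ-at k x u)) ∙≤ compRel-intro t x u

    Ext-elim : ∀ {W} (t : Hom W Y) (u : Hom W A) {ψ : P W} →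
               at (δ Y) (d ∘ π₂) (t ∘ π₁) ∧ at (δ A) (k ∘ π₂) (u ∘ π₁) ≤ reindex π₁ ψ → at Ext t u ≤ ψ
    Ext-elim t u h = compRel-elim t u (∧-mono (proj₁ (Γ°-at d _ _)) (proj₁ (Γ-at k _ _)) ∙≤ h)

    -- On the image of d:  Ext(d x, a) ⟺ k(x) = a   (uses injectivity of d).
    Ext-along-d : at Ext (d ∘ π₁) π₂ ≅ at (δ A) (k ∘ π₁) π₂
    Ext-along-d =
      Ext-elim (d ∘ π₁) π₂
        (∧-glb (∧-lb₁ ∙≤ proj₁ (at-cong ≈-refl assoc) ∙≤ injective-at (proj₁ bij) π₂ (π₁ ∘ π₁) ∙≤
                δ-cong k _ _ ∙≤ δ-sym _ _) ∧-lb₂ ∙≤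
         δ-trans _ _ _ ∙≤ proj₁ (at-cong (≈-sym assoc) ≈-refl) ∙≤ proj₂ (at-∘ π₁)) ,
      (∧-glb (top-max ∙≤ δ-refl (d ∘ π₁)) ≤-refl ∙≤ Ext-intro π₁ (d ∘ π₁) π₂)

    -- Every extension h' of k along d has graph Ext   (uses surjectivity of d).
    extension-graph : ∀ (h' : Hom Y A) → h' ∘ d ≈ k → at (δ A) (h' ∘ π₁) π₂ ≅ at Ext π₁ π₂
    extension-graph h' e = graph≤Ext , Ext≤graph
      where
        graph≤Ext : at (δ A) (h' ∘ π₁) π₂ ≤ at Ext π₁ π₂
        graph≤Ext =
          ∧-glb ≤-refl (top-max ∙≤ surjective-at (proj₂ bij) π₁) ∙≤
          Exists-elim (∧-glb ∧-lb₂
                         (∧-glb (∧-glb (top-max ∙≤ δ-≈ (∘-congˡ (≈-sym e) ∙≈ assoc)) (∧-lb₂ ∙≤ δ-cong h' _ _) ∙≤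
                                 δ-trans _ _ _)
                                (∧-lb₁ ∙≤ proj₁ (at-∘ π₁ ∙≅ at-cong assoc ≈-refl)) ∙≤ δ-trans _ _ _) ∙≤
                       Ext-intro π₂ (π₁ ∘ π₁) (π₂ ∘ π₁) ∙≤ proj₂ (at-∘ π₁))
        Ext≤graph : at Ext π₁ π₂ ≤ at (δ A) (h' ∘ π₁) π₂
        Ext≤graph =
          Ext-elim π₁ π₂
            (∧-glb (∧-glb (∧-lb₁ ∙≤ δ-sym _ _ ∙≤ δ-cong h' _ _)
                          (top-max ∙≤ δ-≈ (≈-sym assoc ∙≈ ∘-congˡ e)) ∙≤ δ-trans _ _ _) ∧-lb₂ ∙≤
             δ-trans _ _ _ ∙≤ proj₂ (at-∘ π₁ ∙≅ at-cong assoc ≈-refl))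

  complete⇒sheaf : ∀ {A} → Complete A → IsSheaf A
  complete⇒sheaf {A} cA {X} {Y} d k bij = h , h∘d≈k , unique
    where
      open SheafExtension d k bij
      h : Hom Y A
      h = proj₁ (cA Y Ext Ext-functional)
      Γh≅Ext : Γ h ≅ Ext
      Γh≅Ext = proj₁ (proj₂ (cA Y Ext Ext-functional))
      h∘d≈k : h ∘ d ≈ k
      h∘d≈k = complete-Γ-injective cA (≅-from-generic
        (Γ-at (h ∘ d) π₁ π₂ ∙≅ at-cong assoc ≈-refl ∙≅ ≅-sym (Γ-at h (d ∘ π₁) π₂) ∙≅
         reindex-cong ⟨ d ∘ π₁ , π₂ ⟩ Γh≅Ext ∙≅ Ext-along-d ∙≅ ≅-sym (Γ-at k π₁ π₂)))
      unique : ∀ h' → h' ∘ d ≈ k → h' ≈ h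
      unique h' e = proj₂ (proj₂ (cA Y Ext Ext-functional)) h'
                      (≅-from-generic (Γ-at h' π₁ π₂ ∙≅ extension-graph h' e))

  -- The inclusion of a comprehension is monic; hence its kernel pair is
  -- trivial and, by Beck–Chevalley, c*(∃_c β) ≅ β.
  module ComprehensionProperties {A} {α : P A} (comprehension : Comprehension α) where
    Carrier : Obj
    Carrier = proj₁ comprehension

    incl : Hom Carrier A
    incl = proj₁ (proj₂ comprehension)

    incl-satisfies : top Carrier ≤ reindex incl α
    incl-satisfies = proj₁ (proj₂ (proj₂ comprehension))

    factor : ∀ {Y} (f : Hom Y A) → top Y ≤ reindex f α → Hom Y Carrier
    factor {Y} f sat = proj₁ (proj₂ (proj₂ (proj₂ comprehension)) Y f sat)

    factor-comm : ∀ {Y} (f : Hom Y A) (sat : top Y ≤ reindex f α) → incl ∘ factor f sat ≈ f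
    factor-comm {Y} f sat = proj₁ (proj₂ (proj₂ (proj₂ (proj₂ comprehension)) Y f sat))

    factor-unique : ∀ {Y} (f : Hom Y A) (sat : top Y ≤ reindex f α) (g : Hom Y Carrier) →
                    incl ∘ g ≈ f → g ≈ factor f sat
    factor-unique {Y} f sat = proj₂ (proj₂ (proj₂ (proj₂ (proj₂ comprehension)) Y f sat))

    incl-mono : ∀ {Z} {u v : Hom Z Carrier} → incl ∘ u ≈ incl ∘ v → u ≈ v
    incl-mono {u = u} {v} e = factor-unique (incl ∘ u) sat u ≈-refl ∙≈ ≈-sym (factor-unique (incl ∘ u) sat v (≈-sym e))
      where
        sat = top≤reindex-top u ∙≤ reindex-mono u incl-satisfies ∙≤ proj₂ (reindex-∘ u incl)

    incl-kernel-pair : IsPullback 𝒞 incl incl id id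
    incl-kernel-pair =
      ≈-refl , λ h k e → h , identityˡ , (identityˡ ∙≈ incl-mono e) , λ u' x y → ≈-sym identityˡ ∙≈ x

    incl-∃-retract : ∀ {β} → reindex incl (∃ incl β) ≅ β
    incl-∃-retract {β} = ≅-sym (beck-chevalley incl incl id id incl-kernel-pair β) ∙≅ ∃-id ∙≅ reindex-id

  module ImageCorestriction {X Y} (f : Hom X Y) (image : HasImage f) where
    open ComprehensionProperties image public

    corestriction : Hom X Carrier
    corestriction = factor f (∃-unit f)

    corestriction-comm : incl ∘ corestriction ≈ f
    corestriction-comm = factor-comm f (∃-unit f)

    corestriction-surjective : InternallySurjective corestriction
    corestriction-surjective =
      top-max ,
      (incl-satisfies ∙≤
       proj₁ (reindex-cong incl (∃-resp (≈-sym corestriction-comm) ∙≅ ∃-∘ corestriction incl) ∙≅ incl-∃-retract))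

  module WithSingletons (singletons : Singletons) where
    open Singletons singletons
    open PowerObjects power

    name-determined : ∀ {X Y} {g g' : Hom Y (ℙ X)} →
                      reindex (id ⁂ g) (∈ X) ≅ reindex (id ⁂ g') (∈ X) → g ≈ g'
    name-determined {g = g} {g'} e = name-unique _ g ≅-refl ∙≈ ≈-sym (name-unique _ g' e)

    surjective-epi : ∀ {X Z A} (e : Hom X Z) → InternallySurjective e → {m m' : Hom Z (ℙ A)} →
                     m ∘ e ≈ m' ∘ e → m ≈ m'
    surjective-epi {Z = Z} {A} e surj eq =
      name-determined (surjective-reflects-≤ e surj (named-along eq) ,
                       surjective-reflects-≤ e surj (named-along (≈-sym eq)))
      where
        named-∘ : ∀ (z : Hom Z (ℙ A)) →
                  reindex (id ⁂ e) (reindex (id ⁂ z) (∈ A)) ≅ reindex (id ⁂ (z ∘ e)) (∈ A)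
        named-∘ z = ≅-sym (reindex-∘ (id ⁂ e) (id ⁂ z)) ∙≅ reindex-resp (⁂-∘-⁂ ∙≈ ⁂-cong identityˡ ≈-refl)
        named-along : ∀ {z z' : Hom Z (ℙ A)} → z ∘ e ≈ z' ∘ e →
                      reindex (id ⁂ e) (reindex (id ⁂ z) (∈ A)) ≤ reindex (id ⁂ e) (reindex (id ⁂ z') (∈ A))
        named-along eq' = proj₁ (named-∘ _ ∙≅ reindex-resp (⁂-cong ≈-refl eq') ∙≅ ≅-sym (named-∘ _))

    singleton : ∀ A → Hom A (ℙ A)
    singleton A = name (δ A)

    singleton-names : ∀ {Y A} (u : Hom Y A) → reindex (id ⁂ (singleton A ∘ u)) (∈ A) ≅ converse (Γ u)
    singleton-names {A = A} u =
      reindex-resp (≈-sym (⁂-∘-⁂ ∙≈ ⁂-cong identityˡ ≈-refl)) ∙≅ reindex-∘ _ _ ∙≅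
      reindex-cong _ (≅-sym (name-spec (δ A))) ∙≅ δ-along-graph u

    module SingletonImage (A : Obj) = ImageCorestriction (singleton A) (singleton-image A)

    corestriction-bijective : ∀ A → InternallyBijective (SingletonImage.corestriction A)
    corestriction-bijective A =
      injective-cancel corestriction-comm (singleton-injective A) , corestriction-surjective
      where open SingletonImage A

    -- A sheaf A is isomorphic to the image of its singleton map.
    module SheafSingleton {A} (sheaf : IsSheaf A) where
      open SingletonImage A

      retraction : Hom Carrier A
      retraction = proj₁ (sheaf corestriction id (corestriction-bijective A))

      retraction-corestriction : retraction ∘ corestriction ≈ id
      retraction-corestriction = proj₁ (proj₂ (sheaf corestriction id (corestriction-bijective A)))

      -- both sides agree after the surjection corestriction, and incl is monic
      corestriction-retraction : corestriction ∘ retraction ≈ id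
      corestriction-retraction =
        incl-mono (surjective-epi corestriction corestriction-surjective after-corestriction ∙≈ ≈-sym identityʳ)
        where
          after-corestriction : (incl ∘ (corestriction ∘ retraction)) ∘ corestriction ≈ incl ∘ corestriction
          after-corestriction = assoc ∙≈ ∘-congʳ (assoc ∙≈ ∘-congʳ retraction-corestriction ∙≈ identityʳ)

      sheaf-Γ-injective : ∀ {Y} {u v : Hom Y A} → Γ u ≅ Γ v → u ≈ v
      sheaf-Γ-injective {u = u} {v} e =
        retraction-cancel retraction-corestriction (incl-mono
          (≈-sym assoc ∙≈ ∘-congˡ corestriction-comm ∙≈ same-singletons ∙≈
           ∘-congˡ (≈-sym corestriction-comm) ∙≈ assoc))
        where
          same-singletons : singleton A ∘ u ≈ singleton A ∘ v
          same-singletons =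
            name-determined (singleton-names u ∙≅ reindex-cong _ e ∙≅ ≅-sym (singleton-names v))

      -- Every functional relation F into a sheaf is a graph: the name g of F°
      -- lands in the image of the singleton map, and f = retraction ∘ g.
      functional-is-graph : ∀ {Y} (F : P (Y ⊗ A)) → Functional F → Σ[ f ∈ Hom Y A ] (Γ f ≅ F)
      functional-is-graph F functional = f , Γf≅F
        where
          g = name (converse F)
          g-names : converse (reindex (id ⁂ g) (∈ A)) ≅ F
          g-names = reindex-cong _ (≅-sym (name-spec (converse F))) ∙≅ converse-involutive
          g-in-image : reindex g (∃ (singleton A) (top A)) ≅ top _
          g-in-image = proj₁ (singleton-functional g) (functional-resp (≅-sym g-names) functional)
          f = retraction ∘ factor g (proj₂ g-in-image)
          singleton-f : singleton A ∘ f ≈ g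
          singleton-f =
            ∘-congˡ (≈-sym corestriction-comm) ∙≈ assoc ∙≈
            ∘-congʳ (≈-sym assoc ∙≈ ∘-congˡ corestriction-retraction ∙≈ identityˡ) ∙≈
            factor-comm g (proj₂ g-in-image)
          Γf≅F : Γ f ≅ F
          Γf≅F = ≅-sym converse-involutive ∙≅
                 reindex-cong _ (≅-sym (singleton-names f) ∙≅ reindex-resp (⁂-cong ≈-refl singleton-f)) ∙≅
                 g-names

    -- Kept abstract: only its statement is used below, and hiding the proof
    -- keeps the conversion checks between objects of Map_c(𝒞,P) cheap.
    abstract
      sheaf⇒complete : ∀ {A} → IsSheaf A → Complete A
      sheaf⇒complete sheaf Y F functional =
        let (f , Γf≅F) = functional-is-graph F functional in
        f , Γf≅F , λ g Γg≅F → sheaf-Γ-injective (Γg≅F ∙≅ ≅-sym Γf≅F)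
        where open SheafSingleton sheaf

    open FunctorData (U mapStructure complete⇒sheaf) using () renaming (F₁ to U₁)

    U-graph : ∀ {X Y} (F : CatData.Hom (Mapc mapStructure) X Y) → Γ (U₁ {X} {Y} F) ≅ proj₁ F
    U-graph {X} {Y} F = proj₁ (proj₂ (proj₂ Y (proj₁ X) (proj₁ F) (proj₂ F)))

    U-unique : ∀ {X Y} (F : CatData.Hom (Mapc mapStructure) X Y) (g : Hom (proj₁ X) (proj₁ Y)) →
               Γ g ≅ proj₁ F → g ≈ U₁ {X} {Y} F
    U-unique {X} {Y} F = proj₂ (proj₂ (proj₂ Y (proj₁ X) (proj₁ F) (proj₂ F)))

    -- Functoriality of U follows from that of Γ, by uniqueness of graph maps.
    U-isFunctor : IsFunctor (U mapStructure complete⇒sheaf)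
    U-isFunctor =
      (λ {X} {Y} {F} {G} F≅G → U-unique {X} {Y} G (U₁ {X} {Y} F) (U-graph {X} {Y} F ∙≅ F≅G)) ,
      (λ {X} → ≈-sym (U-unique {X} {X} (CatData.id (Mapc mapStructure) {X}) id Γ-id)) ,
      (λ {X} {Y} {Z} F G →
        ≈-sym (U-unique {X} {Z} (CatData._∘_ (Mapc mapStructure) {X} {Y} {Z} G F)
                        (U₁ {Y} {Z} G ∘ U₁ {X} {Y} F)
                        (≅-sym (Γ-∘ (U₁ {X} {Y} F) (U₁ {Y} {Z} G)) ∙≅
                         compRel-resp (U-graph {X} {Y} F) (U-graph {Y} {Z} G))))

    V : FunctorData Shv (Mapc mapStructure)
    V = record { F₀ = λ X → proj₁ X , sheaf⇒complete (proj₂ X) ; F₁ = λ f → Γ f , Γ-functional f }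

    V-isFunctor : IsFunctor V
    V-isFunctor = Γ-resp , Γ-id , λ f g → ≅-sym (Γ-∘ f g)

    V∘U≅id : NatIso (V ∘F U mapStructure complete⇒sheaf) idF
    V∘U≅id = record
      { η       = λ X → δ (proj₁ X) , δ-functional _
      ; η⁻¹     = λ X → δ (proj₁ X) , δ-functional _
      ; iso₁    = λ X → compRel-idˡ
      ; iso₂    = λ X → compRel-idˡ
      ; natural = λ {X} {Y} F → compRel-idʳ ∙≅ U-graph {X} {Y} F ∙≅ ≅-sym compRel-idˡ
      }

    U-Γ : ∀ {X Y : Σ[ A ∈ Obj ] IsSheaf A} (f : Hom (proj₁ X) (proj₁ Y)) →
          proj₁ (sheaf⇒complete (proj₂ Y) (proj₁ X) (Γ f) (Γ-functional f)) ≈ f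
    U-Γ {X} {Y} f = ≈-sym (proj₂ (proj₂ (sheaf⇒complete (proj₂ Y) (proj₁ X) (Γ f) (Γ-functional f))) f ≅-refl)

    U∘V≅id : NatIso (U mapStructure complete⇒sheaf ∘F V) idF
    U∘V≅id = record
      { η       = λ X → id
      ; η⁻¹     = λ X → id
      ; iso₁    = λ X → identityˡ
      ; iso₂    = λ X → identityˡ
      ; natural = λ {X} {Y} f → identityˡ ∙≈ U-Γ {X} {Y} f ∙≈ ≈-sym identityʳ
      }

    equivalence : IsEquivalenceFunctor (U mapStructure complete⇒sheaf)
    equivalence = U-isFunctor , V , V-isFunctor , V∘U≅id , U∘V≅id

corollary4p7 : ∀ {o ℓ e p q : Level} {𝒞 : Category o ℓ e} {FP : FiniteProducts 𝒞}
                 {D : Doctrine 𝒞 FP p q} (E : ElementaryExistential D) →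
               Theory.Singletons E →
               Σ[ ms ∈ Categories.MapStructure E ]
                 Σ[ cs ∈ (∀ {A} → Theory.Complete E A → Theory.IsSheaf E A) ]
                   IsEquivalenceFunctor (Categories.U E ms cs)
corollary4p7 E singletons =
  mapStructure , complete⇒sheaf , equivalence
  where
    open InternalLogic E
    open WithSingletons singletons
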